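{- Let $\Sigma$ be a one-sorted signature. If the cell $\langle s,u,v,t\rangle$ is generated by the pullback basis $\mathcal{B}(\Sigma)$, then the cell $\langle u,s,t,v\rangle$ is also generated by $\mathcal{B}(\Sigma)$.
   Context: $\mathbf{Th}[\Sigma]$ is the free algebraic (Lawvere) theory of $\Sigma$: objects are natural numbers $\underline{n}$; an arrow $\underline{n}\to\underline{m}$ is an $m$-tuple of $\Sigma$-terms over $x_1,\dots,x_n$; composition $\alpha;\beta$ (diagrammatic, $\alpha$ first) is substitution; $\otimes$ is juxtaposition on disjoint variable blocks. An $n$-ary $f\in\Sigma$ is the arrow $f\colon\underline{n}\to\underline{1}$. Symmetry $\gamma_{\underline{n},\underline{m}}=\langle x_{n+1},\dots,x_{n+m},x_1,\dots,x_n\rangle$; duplicator $\nabla_{\underline{n}}=\langle x_1,\dots,x_n,x_1,\dots,x_n\rangle\colon\underline{n}\to\underline{2n}$. A cell is a quadruple $\langle s,u,v,t\rangle$ of arrows of $\mathbf{Th}[\Sigma]$ with $s\colon o_1\to o_0$, $u\colon o_2\to o_0$, $v\colon o_3\to o_1$, $t\colon o_3\to o_2$ and $t;u=v;s$. Identity cells: $\langle h,id,id,h\rangle$ and $\langle id,v,v,id\rangle$. Horizontal composition of $A=\langle s_1,u_1,v_1,t_1\rangle$, $B=\langle s_2,u_2,v_2,t_2\rangle$ with $v_1=u_2$: $A*B=\langle s_2;s_1,u_1,v_2,t_2;t_1\rangle$; vertical composition when $t_1=s_2$: $A\cdot B=\langle s_1,u_2;u_1,v_2;v_1,t_2\rangle$;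 parallel composition $\otimes$ componentwise. The pullback basis $\mathcal{B}(\Sigma)$ consists of, for each $n$-ary $f\in\Sigma$: $R_f=\langle f,f,id_{\underline{n}},id_{\underline{n}}\rangle$, $D_f=\langle f\otimes id_{\underline{1}},\nabla_{\underline{1}},\nabla_{\underline{n}};(id_{\underline{n}}\otimes f),f\rangle$, $\hat D_f=\langle\nabla_{\underline{1}},f\otimes id_{\underline{1}},f,\nabla_{\underline{n}};(id_{\underline{n}}\otimes f)\rangle$; and $R_\nabla=\langle\nabla_{\underline{1}},\nabla_{\underline{1}},id_{\underline{1}},id_{\underline{1}}\rangle$, $R_\gamma=\langle\gamma_{\underline{1},\underline{1}},\gamma_{\underline{1},\underline{1}},id_{\underline{2}},id_{\underline{2}}\rangle$, $D_\nabla=\langle\nabla_{\underline{1}}\otimes id_{\underline{1}},id_{\underline{1}}\otimes\nabla_{\underline{1}},\nabla_{\underline{1}},\nabla_{\underline{1}}\rangle$. A cell is generated by $\mathcal{B}(\Sigma)$ if obtained from cells of $\mathcal{B}(\Sigma)$ and identity cells by finitely many horizontal, vertical and parallel compositions. -}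

module Defs where

open import Data.Nat using (ℕ; zero; suc; _+_)
open import Data.Fin using (Fin; zero; suc; _↑ˡ_; _↑ʳ_)
open import Data.Vec using (Vec; []; _∷_; tabulate; _++_)

record Signature : Set₁ where
  field
    Op    : Set
    arity : Op → ℕ
open Signature public

module _ (Σ : Signature) where

  data Term (n : ℕ) : Set where
    var : Fin n → Term n
    app : (f : Op Σ) → Vec (Term n) (arity Σ f) → Term n

-- Arrows n → m of the free Lawvere theory Th[Σ]: m-tuples of terms over n variables.
Arr : (Σ : Signature) → ℕ → ℕ → Set
Arr Σ n m = Vec (Term Σ n) m

module _ {Σ : Signature} where

  mutual
    sub : ∀ {n m} → Arr Σ n m → Term Σ m → Term Σ n
    sub σ (var i)    = Data.Vec.lookup σ i
    sub σ (app f ts) = app f (subs σ ts)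

    subs : ∀ {n m k} → Arr Σ n m → Vec (Term Σ m) k → Vec (Term Σ n) k
    subs σ []       = []
    subs σ (t ∷ ts) = sub σ t ∷ subs σ ts

  -- diagrammatic composition: α first, then β (β's variables replaced by α)
  infixl 5 _⨾_
  _⨾_ : ∀ {n m k} → Arr Σ n m → Arr Σ m k → Arr Σ n k
  α ⨾ β = subs α β

  idA : (n : ℕ) → Arr Σ n n
  idA n = tabulate var

  infixl 6 _⊗_
  _⊗_ : ∀ {n m n' m'} → Arr Σ n m → Arr Σ n' m' → Arr Σ (n + n') (m + m')
  _⊗_ {n} {m} {n'} {m'} α β =
    (tabulate (λ i → var (i ↑ˡ n')) ⨾ α) ++ (tabulate (λ i → var (n ↑ʳ i)) ⨾ β)

  opA : (f : Op Σ) → Arr Σ (arity Σ f) 1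
  opA f = app f (tabulate var) ∷ []

  γ₁₁ : Arr Σ 2 2
  γ₁₁ = var (suc zero) ∷ var zero ∷ []

  ∇ : (n : ℕ) → Arr Σ n (n + n)
  ∇ n = idA n ++ idA n

-- Cells ⟨s,u,v,t⟩ (s : o₁→o₀, u : o₂→o₀, v : o₃→o₁, t : o₃→o₂) generated by
-- the pullback basis B(Σ), identity cells, and horizontal/vertical/parallel composition.
data Generated (Σ : Signature) : ∀ {o₀ o₁ o₂ o₃} →
    Arr Σ o₁ o₀ → Arr Σ o₂ o₀ → Arr Σ o₃ o₁ → Arr Σ o₃ o₂ → Set where
  R-f  : (f : Op Σ) →
         Generated Σ (opA f) (opA f) (idA (arity Σ f)) (idA (arity Σ f))
  D-f  : (f : Op Σ) →
         Generated Σ (opA f ⊗ idA 1) (∇ 1)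
                     (∇ (arity Σ f) ⨾ (idA (arity Σ f) ⊗ opA f)) (opA f)
  D̂-f  : (f : Op Σ) →
         Generated Σ (∇ 1) (opA f ⊗ idA 1) (opA f)
                     (∇ (arity Σ f) ⨾ (idA (arity Σ f) ⊗ opA f))
  R-∇  : Generated Σ (∇ 1) (∇ 1) (idA 1) (idA 1)
  R-γ  : Generated Σ γ₁₁ γ₁₁ (idA 2) (idA 2)
  D-∇  : Generated Σ (∇ 1 ⊗ idA 1) (idA 1 ⊗ ∇ 1) (∇ 1) (∇ 1)
  idH  : ∀ {n m} (h : Arr Σ n m) → Generated Σ h (idA m) (idA n) h
  idV  : ∀ {n m} (v : Arr Σ n m) → Generated Σ (idA m) v v (idA n)
  hor  : ∀ {o₀ o₁ o₂ o₃ p₁ p₃}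
           {s₁ : Arr Σ o₁ o₀} {u₁ : Arr Σ o₂ o₀} {v₁ : Arr Σ o₃ o₁} {t₁ : Arr Σ o₃ o₂}
           {s₂ : Arr Σ p₁ o₁} {v₂ : Arr Σ p₃ p₁} {t₂ : Arr Σ p₃ o₃} →
         Generated Σ s₁ u₁ v₁ t₁ → Generated Σ s₂ v₁ v₂ t₂ →
         Generated Σ (s₂ ⨾ s₁) u₁ v₂ (t₂ ⨾ t₁)
  ver  : ∀ {o₀ o₁ o₂ o₃ p₂ p₃}
           {s₁ : Arr Σ o₁ o₀} {u₁ : Arr Σ o₂ o₀} {v₁ : Arr Σ o₃ o₁} {t₁ : Arr Σ o₃ o₂}
           {u₂ : Arr Σ p₂ o₂} {v₂ : Arr Σ p₃ o₃} {t₂ : Arr Σ p₃ p₂} →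
         Generated Σ s₁ u₁ v₁ t₁ → Generated Σ t₁ u₂ v₂ t₂ →
         Generated Σ s₁ (u₂ ⨾ u₁) (v₂ ⨾ v₁) t₂
  par  : ∀ {o₀ o₁ o₂ o₃ p₀ p₁ p₂ p₃}
           {s₁ : Arr Σ o₁ o₀} {u₁ : Arr Σ o₂ o₀} {v₁ : Arr Σ o₃ o₁} {t₁ : Arr Σ o₃ o₂}
           {s₂ : Arr Σ p₁ p₀} {u₂ : Arr Σ p₂ p₀} {v₂ : Arr Σ p₃ p₁} {t₂ : Arr Σ p₃ p₂} →
         Generated Σ s₁ u₁ v₁ t₁ → Generated Σ s₂ u₂ v₂ t₂ →
         Generated Σ (s₁ ⊗ s₂) (u₁ ⊗ u₂) (v₁ ⊗ v₂) (t₁ ⊗ t₂)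

{-# OPTIONS --safe #-}
-- Transposition swaps horizontal with vertical composition and idH with idV,
-- exchanges D_f and D̂_f, and fixes R_f, R_∇ and R_γ. So the only basis cell
-- whose transpose is not already in the basis is D_∇. Its transpose is D_∇
-- reindexed along symmetries: precompose both s and u with γ (harmless on the
-- other side, as ∇ ⨾ γ = ∇), then postcompose both with the reversal of three
-- wires, itself a composite of R_γ-cells.
module Submission where

open import Data.Nat using (ℕ; zero; suc)
open import Data.Fin using (Fin)
open import Data.Vec using (_∷_; tabulate)
open import Data.Vec.Properties using (tabulate∘lookup)
open import Function using (_∘_)
open import Relation.Binary.PropositionalEquality using (_≡_; refl; trans; cong; subst)
open import Defs

module _ {Σ : Signature} where

  subs-tabulate : ∀ {n m k} (σ : Arr Σ n m) (f : Fin k → Term Σ m) →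
                  subs σ (tabulate f) ≡ tabulate (sub σ ∘ f)
  subs-tabulate {k = zero}  σ f = refl
  subs-tabulate {k = suc k} σ f = cong (sub σ (f Fin.zero) ∷_) (subs-tabulate σ (f ∘ Fin.suc))

  ⨾-identityʳ : ∀ {n m} (α : Arr Σ n m) → α ⨾ idA m ≡ α
  ⨾-identityʳ α = trans (subs-tabulate α var) (tabulate∘lookup α)

  whisker : ∀ {o₀ o₁ o₂ o₃ k} {p : Arr Σ o₀ k}
              {s : Arr Σ o₁ o₀} {u : Arr Σ o₂ o₀} {v : Arr Σ o₃ o₁} {t : Arr Σ o₃ o₂} →
            Generated Σ p p (idA o₀) (idA o₀) → Generated Σ s u v t →
            Generated Σ (s ⨾ p) (u ⨾ p) v t
  whisker {s = s} {u} {v} {t} Rp C =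
    subst (λ v′ → Generated Σ (s ⨾ _) (u ⨾ _) v′ t) (⨾-identityʳ v)
      (ver (subst (Generated Σ (s ⨾ _) _ _) (⨾-identityʳ s) (hor Rp (idH s))) C)

  reverse₃ : Arr Σ 3 3
  reverse₃ = (γ₁₁ ⊗ idA 1) ⨾ (idA 1 ⊗ γ₁₁) ⨾ (γ₁₁ ⊗ idA 1)

  R-reverse₃ : Generated Σ reverse₃ reverse₃ (idA 3) (idA 3)
  R-reverse₃ = whisker R-γ⊗id (whisker R-id⊗γ R-γ⊗id)
    where
    R-γ⊗id : Generated Σ (γ₁₁ ⊗ idA 1) (γ₁₁ ⊗ idA 1) (idA 3) (idA 3)
    R-γ⊗id = par R-γ (idH (idA 1))
    R-id⊗γ : Generated Σ (idA 1 ⊗ γ₁₁) (idA 1 ⊗ γ₁₁) (idA 3) (idA 3)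
    R-id⊗γ = par (idH (idA 1)) R-γ

  -- Both pasted cells are R-γ glued to an identity cell on ∇ 1, which fits because ∇ 1 ⨾ γ₁₁ = ∇ 1.
  D-∇-twisted : Generated Σ (γ₁₁ ⨾ (∇ 1 ⊗ idA 1)) (γ₁₁ ⨾ (idA 1 ⊗ ∇ 1)) (∇ 1) (∇ 1)
  D-∇-twisted = ver (hor D-∇ (ver R-γ (idV (∇ 1)))) (hor R-γ (idH (∇ 1)))

  D-∇ᵀ : Generated Σ (idA 1 ⊗ ∇ 1) (∇ 1 ⊗ idA 1) (∇ 1) (∇ 1)
  D-∇ᵀ = whisker R-reverse₃ D-∇-twisted

transpose : ∀ {Σ o₀ o₁ o₂ o₃}
              {s : Arr Σ o₁ o₀} {u : Arr Σ o₂ o₀} {v : Arr Σ o₃ o₁} {t : Arr Σ o₃ o₂} →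
            Generated Σ s u v t → Generated Σ u s t v
transpose (R-f f)   = R-f f
transpose (D-f f)   = D̂-f f
transpose (D̂-f f)   = D-f f
transpose R-∇       = R-∇
transpose R-γ       = R-γ
transpose D-∇       = D-∇ᵀ
transpose (idH h)   = idV h
transpose (idV v)   = idH v
transpose (hor A B) = ver (transpose A) (transpose B)
transpose (ver A B) = hor (transpose A) (transpose B)
transpose (par A B) = par (transpose A) (transpose B)

lemma3p8 : (Σ : Signature) {o₀ o₁ o₂ o₃ : ℕ}
           (s : Arr Σ o₁ o₀) (u : Arr Σ o₂ o₀) (v : Arr Σ o₃ o₁) (t : Arr Σ o₃ o₂) →
           Generated Σ s u v t → Generated Σ u s t v
lemma3p8 Σ s u v t = transpose
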